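{- Let $G$ be a bipartite graph, let $E$ be a set of edges of $G$, and let $I$ be a maximum independent set in $G$. Then $I$ has an $E$-good accessibility ordering if and only if for every $E$-good partial accessibility ordering $\sigma': x'_1,\ldots,x'_{\ell-1}$ for $I$ with $0\le \ell-1<|I|$, there is a vertex $x'_\ell\in I$ such that $\sigma'': x'_1,\ldots,x'_{\ell-1},x'_\ell$ is an $E$-good partial accessibility ordering for $I$ (that is, every $E$-good partial accessibility ordering for $I$ that does not contain all of $I$ can be extended by one element).
   Context: Graphs are finite and simple. For an independent set $J$ (in particular a subset of $I$) in a bipartite graph $G$ and a linear ordering $\sigma: x_1,\ldots,x_k$ of $J$, let $J^\sigma_{\le j}=\{x_i:1\le i\le j\}$ for $0\le j\le k$. For $y\in N_G(J)$ let $p(y)=x_i$ where $i$ is the smallest index with $y\in N_G(x_i)$, and let $M^\sigma=\{y\,p(y): y\in N_G(J)\}$. The ordering $\sigma$ is $E$-good if $M^\sigma\subseteq E$. It is an accessibility ordering for $J$ if $|N_G(J^\sigma_{\le j})|-|N_G(J^\sigma_{\le j-1})|\le 1$ for every $j\in\{1,\ldots,k\}$. A partial accessibility ordering for $I$ is an accessibility ordering for some subset $I'$ of $I$ (the empty ordering included). -}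

module Defs where

open import Data.Nat using (ℕ; zero; suc; _≤_; _<_)
open import Data.Bool using (Bool; true; false)
open import Data.Fin using (Fin)
open import Data.Fin.Subset using (Subset; _∈_; ∣_∣)
open import Data.Vec using (tabulate)
open import Data.List using (List; []; _∷_; take; length)
open import Data.List.Relation.Unary.Unique.Propositional using (Unique)
open import Data.List.Relation.Unary.All using (All)
open import Data.List.Relation.Unary.Any using (any?)
import Data.List.Membership.Propositional as L
open import Data.Maybe using (Maybe; just; nothing)
open import Data.Product using (Σ; ∃; _×_)
open import Relation.Nullary using (¬_; Dec; yes; no; does)
open import Relation.Binary using (Rel; Decidable; Symmetric; Irreflexive)
open import Relation.Binary.PropositionalEquality using (_≡_; _≢_)
open import Level using (0ℓ)

record Graph (n : ℕ) : Set₁ where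
  field
    Adj     : Rel (Fin n) 0ℓ
    adj?    : Decidable Adj
    symAdj  : Symmetric Adj
    irrAdj  : Irreflexive _≡_ Adj

module _ {n : ℕ} (G : Graph n) where
  open Graph G

  Bipartite : Set
  Bipartite = Σ (Fin n → Bool) λ c → ∀ x y → Adj x y → c x ≢ c y

  -- E is a set of edges of G (edges are unordered, so E is symmetric).
  EdgeSet : Rel (Fin n) 0ℓ → Set
  EdgeSet E = (∀ x y → E x y → Adj x y) × Symmetric E

  Independent : Subset n → Set
  Independent I = ∀ x y → x ∈ I → y ∈ I → ¬ Adj x y

  MaximumIndependent : Subset n → Set
  MaximumIndependent I = Independent I × (∀ J → Independent J → ∣ J ∣ ≤ ∣ I ∣)

  N : List (Fin n) → Subset n
  N J = tabulate λ y → does (any? (adj? y) J)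

  p : List (Fin n) → Fin n → Maybe (Fin n)
  p [] y = nothing
  p (x ∷ σ) y with adj? y x
  ... | yes _ = just x
  ... | no _  = p σ y

  -- σ is E-good: M^σ ⊆ E, i.e. every edge y p(y) lies in E.
  EGood : Rel (Fin n) 0ℓ → List (Fin n) → Set
  EGood E σ = ∀ y x → p σ y ≡ just x → E y x

  AccessibilityCond : List (Fin n) → Set
  AccessibilityCond σ =
    ∀ j → j < length σ → ∣ N (take (suc j) σ) ∣ ≤ suc ∣ N (take j σ) ∣

  PartialOrderingOf : Subset n → List (Fin n) → Set
  PartialOrderingOf I σ = Unique σ × All (_∈ I) σ

  OrderingOf : Subset n → List (Fin n) → Set
  OrderingOf I σ = PartialOrderingOf I σ × (∀ x → x ∈ I → x L.∈ σ)

  PartialAccessibilityOrdering : Subset n → List (Fin n) → Set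
  PartialAccessibilityOrdering I σ = PartialOrderingOf I σ × AccessibilityCond σ

  AccessibilityOrdering : Subset n → List (Fin n) → Set
  AccessibilityOrdering I σ = OrderingOf I σ × AccessibilityCond σ

module Submission where

open import Defs
open import Data.Nat using (ℕ; _<_)
open import Data.Fin using (Fin)
open import Data.Fin.Subset using (Subset; _∈_; ∣_∣)
open import Data.List using (List; length; _++_; [_])
open import Data.Product using (Σ; _×_)
open import Relation.Binary using (Rel)
open import Function.Bundles using (_⇔_)
open import Level using (0ℓ)

open import Data.Nat using (zero; suc; _+_; _≤_; _<?_; z≤n; s≤s)
open import Data.Nat.Properties
  using (≤-refl; ≤-reflexive; ≤-trans; +-suc; +-comm; +-monoʳ-≤; +-cancelˡ-≤; <⇒≱; <⇒≤; +-identityʳ; m<1+n⇒m<n∨m≡n)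
open import Data.Bool using (true; T)
open import Data.Unit using (tt)
open import Data.Fin using (_≟_)
open import Data.Fin.Subset using (_⊆_; _∉_; _∪_; _─_; _-_; ⁅_⁆; inside; outside)
open import Data.Fin.Subset.Properties
  using (p─q⊆p; x∈p∧x≢y⇒x∈p-y; x∈p⇒∣p-x∣<∣p∣; x∈⁅x⁆; ∣⁅x⁆∣≡1; ∣q∣≤∣p∪q∣; Empty-unique; ∣⊥∣≡0;
         x∈p∪q⁺; x∈p∪q⁻; p⊆q⇒∣p∣≤∣q∣; ⊆-antisym; x∈p∧x∉q⇒x∈p─q)
open import Data.Vec using (_∷_; []; here; there)
open import Data.Vec.Properties using (lookup∘tabulate; []=⇒lookup; lookup⇒[]=)
open import Data.List using ([]; _∷_; take)
open import Data.List.Properties using (length-++-sucʳ; ++-identityʳ; take-all)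
open import Data.List.Relation.Unary.All as All using (All; []; _∷_)
open import Data.List.Relation.Unary.All.Properties using (¬Any⇒All¬)
import Data.List.Relation.Unary.All.Properties as All
open import Data.List.Relation.Unary.AllPairs using ([]; _∷_)
open import Data.List.Relation.Unary.Any using (Any; here; there; any?)
open import Data.List.Relation.Unary.Any.Properties using (++⁺ˡ; ++⁺ʳ; ++⁻)
open import Data.List.Relation.Unary.First using (first) renaming (_++_∷_ to split-at)
open import Data.List.Relation.Unary.First.Properties using (toView)
open import Data.List.Relation.Unary.Unique.Propositional using (Unique)
import Data.List.Relation.Unary.Unique.Propositional.Properties as Unique
open import Data.List.Relation.Binary.Subset.Propositional.Properties using (Any-resp-⊆)
import Data.List.Membership.Propositional as L
import Data.List.Membership.Propositional.Properties as L
open import Data.Maybe using (just; nothing; _<∣>_)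
open import Data.Product using (_,_)
open import Data.Sum using (inj₁; inj₂)
open import Function using (_∘_)
open import Relation.Nullary using (¬_; Dec; yes; no; does; contradiction)
open import Relation.Nullary.Decidable using (dec-true; toWitness; toSum; isYes≗does)
open import Relation.Binary.PropositionalEquality
  using (_≡_; refl; sym; trans; cong; subst; subst₂; module ≡-Reasoning)
open import Function.Bundles using (mk⇔)

-- For a list J of vertices write gain J x = ∣ N(x) ─ N(J) ∣ for the number of
-- new neighbours x brings, so that ∣ N(J ++ [ x ]) ∣ = ∣ N(J) ∣ + gain J x and the
-- accessibility condition says that every vertex gains at most one neighbour over its
-- prefix.  Since N(J) only grows with J, gain J x can only shrink as J grows
-- (submodularity of ∣ N ∣).
--
-- (⇒) Given an E-good accessibility ordering σ of I and a shorter E-good partial one σ′,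
-- let x be the first vertex of σ = pre ++ x ∷ rest not in σ′ (one exists by counting).
-- Then pre ⊆ σ′, so x gains at most one neighbour over σ′; and a vertex whose first
-- neighbour in σ′ ++ [ x ] is x has none in σ′, hence none in pre, so its edge to x is
-- already an edge y p(y) of σ, and lies in E.
-- (⇐) Starting from the empty ordering, extend ∣ I ∣ times; a duplicate-free list of
-- ∣ I ∣ elements of I contains all of I.

private
  variable
    n : ℕ

∣p∪q∣≡∣p∣+∣q─p∣ : (p q : Subset n) → ∣ p ∪ q ∣ ≡ ∣ p ∣ + ∣ q ─ p ∣
∣p∪q∣≡∣p∣+∣q─p∣ []            []            = refl
∣p∪q∣≡∣p∣+∣q─p∣ (inside  ∷ p) (outside ∷ q) = cong suc (∣p∪q∣≡∣p∣+∣q─p∣ p q)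
∣p∪q∣≡∣p∣+∣q─p∣ (inside  ∷ p) (inside  ∷ q) = cong suc (∣p∪q∣≡∣p∣+∣q─p∣ p q)
∣p∪q∣≡∣p∣+∣q─p∣ (outside ∷ p) (outside ∷ q) = ∣p∪q∣≡∣p∣+∣q─p∣ p q
∣p∪q∣≡∣p∣+∣q─p∣ (outside ∷ p) (inside  ∷ q) =
  trans (cong suc (∣p∪q∣≡∣p∣+∣q─p∣ p q)) (sym (+-suc ∣ p ∣ ∣ q ─ p ∣))

x∈p─q⇒x∉q : ∀ {x} (p q : Subset n) → x ∈ p ─ q → x ∉ q
x∈p─q⇒x∉q (inside  ∷ p) (outside ∷ q) here      ()
x∈p─q⇒x∉q (_       ∷ p) (_       ∷ q) (there m) (there m′) = x∈p─q⇒x∉q p q m m′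

─-antitoneʳ : ∀ {p q} (r : Subset n) → p ⊆ q → r ─ q ⊆ r ─ p
─-antitoneʳ {q = q} r p⊆q x∈r─q = x∈p∧x∉q⇒x∈p─q (p─q⊆p r q x∈r─q) (x∈p─q⇒x∉q r q x∈r─q ∘ p⊆q)

∣p∣≤1+∣p-x∣ : (p : Subset n) (x : Fin n) → ∣ p ∣ ≤ suc ∣ p - x ∣
∣p∣≤1+∣p-x∣ p x = ≤-trans (∣q∣≤∣p∪q∣ ⁅ x ⁆ p)
  (≤-reflexive (trans (∣p∪q∣≡∣p∣+∣q─p∣ ⁅ x ⁆ p) (cong (_+ ∣ p - x ∣) (∣⁅x⁆∣≡1 x))))

unique⇒length≤∣p∣ : ∀ {p : Subset n} {xs} → Unique xs → All (_∈ p) xs → length xs ≤ ∣ p ∣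
unique⇒length≤∣p∣ []                 []           = z≤n
unique⇒length≤∣p∣ {p = p} {x ∷ xs} (x∉xs ∷ u) (x∈p ∷ xs⊆p) =
  ≤-trans (s≤s (unique⇒length≤∣p∣ u xs⊆p-x)) (x∈p⇒∣p-x∣<∣p∣ x∈p)
  where
  xs⊆p-x : All (_∈ p - x) xs
  xs⊆p-x = All.zipWith (λ (y∈p , x≢y) → x∈p∧x≢y⇒x∈p-y y∈p (x≢y ∘ sym)) (xs⊆p , x∉xs)

covering⇒∣p∣≤length : ∀ {p : Subset n} xs → (∀ x → x ∈ p → x L.∈ xs) → ∣ p ∣ ≤ length xs
covering⇒∣p∣≤length {n} {p = p} [] covers =
  ≤-reflexive (trans (cong ∣_∣ (Empty-unique λ (x , x∈p) → empty (covers x x∈p))) (∣⊥∣≡0 n))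
  where
  empty : ∀ {x} → ¬ x L.∈ []
  empty ()
covering⇒∣p∣≤length {p = p} (x ∷ xs) covers =
  ≤-trans (∣p∣≤1+∣p-x∣ p x) (s≤s (covering⇒∣p∣≤length xs covers′))
  where
  covers′ : ∀ y → y ∈ p - x → y L.∈ xs
  covers′ y y∈p-x with covers y (p─q⊆p p ⁅ x ⁆ y∈p-x)
  ... | here refl = contradiction (x∈⁅x⁆ y) (x∈p─q⇒x∉q p ⁅ x ⁆ y∈p-x)
  ... | there y∈xs = y∈xs

module _ {A : Set} where

  take-++-≤ : ∀ j (xs ys : List A) → j ≤ length xs → take j (xs ++ ys) ≡ take j xs
  take-++-≤ zero    xs       ys _         = refl
  take-++-≤ (suc j) (x ∷ xs) ys (s≤s j≤) = cong (x ∷_) (take-++-≤ j xs ys j≤)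

  take-length-++ : (xs ys : List A) → take (length xs) (xs ++ ys) ≡ xs
  take-length-++ xs ys = trans (take-++-≤ (length xs) xs ys ≤-refl) (take-all (length xs) xs ≤-refl)

  take-suc-length-++ : (xs : List A) (y : A) (ys : List A) →
                       take (suc (length xs)) (xs ++ y ∷ ys) ≡ xs ++ [ y ]
  take-suc-length-++ []       y ys = refl
  take-suc-length-++ (x ∷ xs) y ys = cong (x ∷_) (take-suc-length-++ xs y ys)

  length-<-++∷ : (xs : List A) (y : A) (ys : List A) → length xs < length (xs ++ y ∷ ys)
  length-<-++∷ []       y ys = s≤s z≤n
  length-<-++∷ (x ∷ xs) y ys = s≤s (length-<-++∷ xs y ys)

  length-snoc : (xs : List A) (y : A) → length (xs ++ [ y ]) ≡ suc (length xs)
  length-snoc xs y = trans (length-++-sucʳ xs y []) (cong (suc ∘ length) (++-identityʳ xs))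

module Neighbourhood {n : ℕ} (G : Graph n) where
  open Graph G

  ∈N⇒Any : ∀ {y J} → y ∈ N G J → Any (Adj y) J
  ∈N⇒Any {y} {J} y∈N = toWitness {a? = y-adj?} (subst T (sym (trans (isYes≗does y-adj?) y-marked)) tt)
    where
    y-adj? : Dec (Any (Adj y) J)
    y-adj? = any? (adj? y) J
    y-marked : does y-adj? ≡ true
    y-marked = trans (sym (lookup∘tabulate _ y)) ([]=⇒lookup y∈N)

  Any⇒∈N : ∀ {y J} → Any (Adj y) J → y ∈ N G J
  Any⇒∈N {y} {J} adj =
    lookup⇒[]= y (N G J) (trans (lookup∘tabulate _ y) (dec-true (any? (adj? y) J) adj))

  N-++ : (J K : List (Fin n)) → N G (J ++ K) ≡ N G J ∪ N G K
  N-++ J K = ⊆-antisym split join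
    where
    split : N G (J ++ K) ⊆ N G J ∪ N G K
    split y∈N with ++⁻ J (∈N⇒Any y∈N)
    ... | inj₁ adj = x∈p∪q⁺ (inj₁ (Any⇒∈N adj))
    ... | inj₂ adj = x∈p∪q⁺ (inj₂ (Any⇒∈N adj))
    join : N G J ∪ N G K ⊆ N G (J ++ K)
    join y∈N with x∈p∪q⁻ (N G J) (N G K) y∈N
    ... | inj₁ y∈NJ = Any⇒∈N (++⁺ˡ (∈N⇒Any {J = J} y∈NJ))
    ... | inj₂ y∈NK = Any⇒∈N (++⁺ʳ J (∈N⇒Any {J = K} y∈NK))

  N-mono : ∀ {J J′} → All (L._∈ J′) J → N G J ⊆ N G J′
  N-mono J⊆J′ y∈N = Any⇒∈N (Any-resp-⊆ (All.lookup J⊆J′) (∈N⇒Any y∈N))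

  gain : List (Fin n) → Fin n → ℕ
  gain J x = ∣ N G [ x ] ─ N G J ∣

  ∣N-snoc∣ : ∀ J x → ∣ N G (J ++ [ x ]) ∣ ≡ ∣ N G J ∣ + gain J x
  ∣N-snoc∣ J x = trans (cong ∣_∣ (N-++ J [ x ])) (∣p∪q∣≡∣p∣+∣q─p∣ (N G J) (N G [ x ]))

  gain-antitone : ∀ {J J′} x → All (L._∈ J′) J → gain J′ x ≤ gain J x
  gain-antitone x J⊆J′ = p⊆q⇒∣p∣≤∣q∣ (─-antitoneʳ (N G [ x ]) (N-mono J⊆J′))

  step⇒gain≤1 : ∀ J x → ∣ N G (J ++ [ x ]) ∣ ≤ suc ∣ N G J ∣ → gain J x ≤ 1
  step⇒gain≤1 J x step = +-cancelˡ-≤ ∣ N G J ∣ (gain J x) 1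
    (subst₂ _≤_ (∣N-snoc∣ J x) (+-comm 1 ∣ N G J ∣) step)

  gain≤1⇒step : ∀ J x → gain J x ≤ 1 → ∣ N G (J ++ [ x ]) ∣ ≤ suc ∣ N G J ∣
  gain≤1⇒step J x g≤1 = subst₂ _≤_ (sym (∣N-snoc∣ J x)) (+-comm ∣ N G J ∣ 1)
    (+-monoʳ-≤ ∣ N G J ∣ g≤1)

  accessible-at : ∀ pre x rest → AccessibilityCond G (pre ++ x ∷ rest) → gain pre x ≤ 1
  accessible-at pre x rest acc = step⇒gain≤1 pre x
    (subst₂ (λ J J′ → ∣ N G J ∣ ≤ suc ∣ N G J′ ∣)
      (take-suc-length-++ pre x rest) (take-length-++ pre (x ∷ rest))
      (acc (length pre) (length-<-++∷ pre x rest)))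

  accessible-snoc : ∀ σ x → AccessibilityCond G σ → gain σ x ≤ 1 → AccessibilityCond G (σ ++ [ x ])
  accessible-snoc σ x acc g≤1 j j< with m<1+n⇒m<n∨m≡n (subst (j <_) (length-snoc σ x) j<)
  ... | inj₁ j<σ = subst₂ (λ J J′ → ∣ N G J ∣ ≤ suc ∣ N G J′ ∣)
                     (sym (take-++-≤ (suc j) σ [ x ] j<σ)) (sym (take-++-≤ j σ [ x ] (<⇒≤ j<σ)))
                     (acc j j<σ)
  ... | inj₂ refl = subst₂ (λ J J′ → ∣ N G J ∣ ≤ suc ∣ N G J′ ∣)
                     (sym (take-suc-length-++ σ x [])) (sym (take-length-++ σ [ x ]))
                     (gain≤1⇒step σ x g≤1)

module FirstNeighbour {n : ℕ} (G : Graph n) where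
  open Graph G
  open ≡-Reasoning

  p-++ : ∀ J K y → p G (J ++ K) y ≡ (p G J y <∣> p G K y)
  p-++ []      K y = refl
  p-++ (x ∷ J) K y with adj? y x
  ... | yes _ = refl
  ... | no  _ = p-++ J K y

  p≡nothing⇒¬Any : ∀ J y → p G J y ≡ nothing → ¬ Any (Adj y) J
  p≡nothing⇒¬Any (x ∷ J) y p≡ adj with adj? y x | adj
  p≡nothing⇒¬Any (x ∷ J) y () adj | yes _  | _
  ... | no ¬yx | here yx   = ¬yx yx
  ... | no _   | there adj′ = p≡nothing⇒¬Any J y p≡ adj′

  ¬Any⇒p≡nothing : ∀ J y → ¬ Any (Adj y) J → p G J y ≡ nothing
  ¬Any⇒p≡nothing []      y _    = refl
  ¬Any⇒p≡nothing (x ∷ J) y ¬adj with adj? y x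
  ... | yes yx = contradiction (here yx) ¬adj
  ... | no  _  = ¬Any⇒p≡nothing J y (¬adj ∘ there)

  p-head : ∀ x J y → Adj y x → p G (x ∷ J) y ≡ just x
  p-head x J y yx with adj? y x
  ... | yes _   = refl
  ... | no ¬yx = contradiction yx ¬yx

  p-singleton : ∀ x y {z} → p G [ x ] y ≡ just z → z ≡ x × Adj y x
  p-singleton x y p≡ with adj? y x
  p-singleton x y refl | yes yx = refl , yx
  p-singleton x y ()   | no  _

  -- Appending to σ′ the first vertex x of an E-good ordering σ that is missing from σ′
  -- keeps σ′ E-good: every vertex whose first neighbour becomes x has no neighbour in σ′,
  -- hence none before x in σ, so its first neighbour in σ is x as well.
  EGood-snoc : ∀ (E : Rel (Fin n) 0ℓ) pre x rest σ′ → All (L._∈ σ′) pre →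
               EGood G E (pre ++ x ∷ rest) → EGood G E σ′ → EGood G E (σ′ ++ [ x ])
  EGood-snoc E pre x rest σ′ pre⊆σ′ good good′ y z p≡z =
    new-edge (p G σ′ y) refl (trans (sym (p-++ σ′ [ x ] y)) p≡z)
    where
    new-edge : ∀ m → p G σ′ y ≡ m → (m <∣> p G [ x ] y) ≡ just z → E y z
    new-edge (just w) p≡w refl = good′ y w p≡w
    new-edge nothing  p≡∅ p≡z′ with p-singleton x y p≡z′
    ... | refl , yx = good y x (begin
      p G (pre ++ x ∷ rest) y          ≡⟨ p-++ pre (x ∷ rest) y ⟩
      (p G pre y <∣> p G (x ∷ rest) y) ≡⟨ cong (_<∣> p G (x ∷ rest) y) pre-∅ ⟩
      p G (x ∷ rest) y                 ≡⟨ p-head x rest y yx ⟩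
      just x                           ∎)
      where
      pre-∅ : p G pre y ≡ nothing
      pre-∅ = ¬Any⇒p≡nothing pre y (p≡nothing⇒¬Any σ′ y p≡∅ ∘ Any-resp-⊆ (All.lookup pre⊆σ′))

module Extension {n : ℕ} (G : Graph n) (E : Rel (Fin n) 0ℓ) (I : Subset n) where
  open Neighbourhood G
  open FirstNeighbour G
  open import Data.List.Membership.DecPropositional (_≟_ {n}) using (_∈?_)

  GoodPartial : List (Fin n) → Set
  GoodPartial σ = PartialAccessibilityOrdering G I σ × EGood G E σ

  GoodOrdering : Set
  GoodOrdering = Σ (List (Fin n)) λ σ → AccessibilityOrdering G I σ × EGood G E σ

  Extendable : List (Fin n) → Set
  Extendable σ = Σ (Fin n) λ x → x ∈ I × GoodPartial (σ ++ [ x ])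

  ExtensionProperty : Set
  ExtensionProperty = (σ′ : List (Fin n)) → PartialAccessibilityOrdering G I σ′ → EGood G E σ′ →
                      length σ′ < ∣ I ∣ → Extendable σ′

  saturated : ∀ σ → PartialOrderingOf G I σ → ¬ length σ < ∣ I ∣ → ∀ y → y ∈ I → y L.∈ σ
  saturated σ (unique , σ⊆I) long y y∈I with y ∈? σ
  ... | yes y∈σ = y∈σ
  ... | no  y∉σ = contradiction
        (unique⇒length≤∣p∣ (¬Any⇒All¬ σ y∉σ ∷ unique) (y∈I ∷ σ⊆I)) long

  -- If x is the first vertex of a good ordering σ = pre ++ x ∷ rest of I missing from σ′,
  -- then σ′ ++ [ x ] is again good: uniqueness is clear, the E-good property transfers
  -- by EGood-snoc, and x gains at most one neighbour over σ′ ⊇ pre by submodularity.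
  extend-by-missing : ∀ pre x rest σ′ →
                      AccessibilityOrdering G I (pre ++ x ∷ rest) → EGood G E (pre ++ x ∷ rest) →
                      GoodPartial σ′ → All (L._∈ σ′) pre → ¬ x L.∈ σ′ → Extendable σ′
  extend-by-missing pre x rest σ′ (((_ , σ⊆I) , _) , acc) good (((unique′ , σ′⊆I) , acc′) , good′)
                    pre⊆σ′ x∉σ′ =
    x , x∈I , ((unique-snoc , All.++⁺ σ′⊆I (x∈I ∷ [])) , acc-snoc) ,
    EGood-snoc E pre x rest σ′ pre⊆σ′ good good′
    where
    x∈I : x ∈ I
    x∈I = All.lookup σ⊆I (L.∈-++⁺ʳ pre (here refl))
    unique-snoc : Unique (σ′ ++ [ x ])
    unique-snoc = Unique.++⁺ unique′ ([] ∷ []) λ { (x∈σ′ , here refl) → x∉σ′ x∈σ′ }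
    acc-snoc : AccessibilityCond G (σ′ ++ [ x ])
    acc-snoc = accessible-snoc σ′ x acc′
      (≤-trans (gain-antitone x pre⊆σ′) (accessible-at pre x rest acc))

  forward : GoodOrdering → ExtensionProperty
  forward (σ , ordering@((_ , I⊆σ) , _) , good) σ′ partial′ good′ short
    with first (λ y → toSum (y ∈? σ′)) σ
  ... | inj₂ σ⊆σ′ = contradiction (covering⇒∣p∣≤length σ′ I⊆σ′) (<⇒≱ short)
    where
    I⊆σ′ : ∀ y → y ∈ I → y L.∈ σ′
    I⊆σ′ y y∈I = All.lookup σ⊆σ′ (I⊆σ y y∈I)
  ... | inj₁ missing with toView missing
  ...   | split-at pre⊆σ′ x∉σ′ rest =
          extend-by-missing _ _ rest σ′ ordering good (partial′ , good′) pre⊆σ′ x∉σ′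

  -- Conversely, repeated extension produces a good ordering of all of I; the fuel k bounds
  -- the number of extensions still needed, and ∣ I ∣ steps suffice from the empty ordering.
  extend-greedily : ExtensionProperty → ∀ k σ′ → GoodPartial σ′ → ∣ I ∣ ≤ k + length σ′ → GoodOrdering
  extend-greedily extend k σ′ ((partial , acc) , good) bound with length σ′ <? ∣ I ∣
  ... | no full = σ′ , ((partial , saturated σ′ partial full) , acc) , good
  extend-greedily extend zero    σ′ _ bound | yes short = contradiction bound (<⇒≱ short)
  extend-greedily extend (suc k) σ′ ((partial , acc) , good) bound | yes short
    with extend σ′ (partial , acc) good short
  ... | x , _ , good-snoc = extend-greedily extend k (σ′ ++ [ x ]) good-snoc
          (subst (∣ I ∣ ≤_) (trans (sym (+-suc k (length σ′))) (cong (k +_) (sym (length-snoc σ′ x)))) bound)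

  backward : ExtensionProperty → GoodOrdering
  backward extend =
    extend-greedily extend ∣ I ∣ [] ((([] , []) , λ _ ()) , λ _ _ ()) (≤-reflexive (sym (+-identityʳ ∣ I ∣)))

lemma3 : {n : ℕ} (G : Graph n) → Bipartite G →
         (E : Rel (Fin n) 0ℓ) → EdgeSet G E →
         (I : Subset n) → MaximumIndependent G I →
         (Σ (List (Fin n)) λ σ → AccessibilityOrdering G I σ × EGood G E σ)
         ⇔
         ((σ′ : List (Fin n)) → PartialAccessibilityOrdering G I σ′ → EGood G E σ′ →
           length σ′ < ∣ I ∣ →
           Σ (Fin n) λ x → x ∈ I ×
             PartialAccessibilityOrdering G I (σ′ ++ [ x ]) × EGood G E (σ′ ++ [ x ]))
lemma3 G _ E _ I _ = mk⇔ forward backward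
  where open Extension G E I
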